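{- Let $P$ be a finite poset. If the symmetric twin-width of $P$ is $d_s$ and the natural twin-width of $P$ is $d$, then $d\leq d_s\leq d+1$.
   Context: Posets are finite; for a poset $P=(X,\leq_P)$ write $a\sim_P b$ if $a\leq_P b$ or $b\leq_P a$. Symmetric twin-width. Let $\mathbf A$ be a square matrix with entries from a finite set whose rows and columns are both indexed by a ground set $X$, $|X|=n$. For a partition $\mathcal R$ of $X$ into nonempty parts and $R,Q\in\mathcal R$, the $R\times Q$ zone is the submatrix with rows in $R$ and columns in $Q$; it is constant if all its entries are equal. For $P\in\mathcal R$, the error value of the row $P$ (resp. column $P$) is the number of $Q\in\mathcal R$ (including $Q=P$) such that the zone $P\times Q$ (resp. $Q\times P$) is non-constant. $\mathbf A$ has symmetric twin-width at most $d$ if there is a sequence of partitions $\mathcal R^1,\dots,\mathcal R^n$ of $X$ with $\mathcal R^1$ the partition into singletons, $\mathcal R^n=\{X\}$, each $\mathcal R^{i+1}$ obtained from $\mathcal R^i$ by merging two parts, and such that for every $i$ and every $P\in\mathcal R^i$ the error values of row $P$ and column $P$ are at most $d$. For a poset $P=(X,\leq_P)$ let $\mathbf A_P=(a_{u,v})_{u,v\in X}$ with $a_{u,v}=1$ if $u\leq_P v$, $a_{u,v}=-1$ if $v\leq_P u$ and $v\neq u$, and $a_{u,v}=0$ otherwise. The symmetric twin-width of $P$ is the least $d$ such that $\mathbf A_P$ has symmetric twin-width at most $d$. Natural twin-width. A red poset is a triple $(X,\leq_P,R)$ where $(X,\leq_P)$ is a poset and $R$ is a set of unordered pairs of incomparable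 elements ("red edges"); its red degree is the maximum degree of the graph $(X,R)$. A contraction of two distinct vertices $x_1,x_2$ into a new vertex $x$ produces the red poset $(X',\leq',R')$ with $X'=(X\setminus\{x_1,x_2\})\cup\{x\}$, where: for $a,b\in X\setminus\{x_1,x_2\}$, $a\leq' b$ iff $a\leq_P b$; $x\leq' x$; $a\leq' x$ iff $a\leq_P x_1$ and $a\leq_P x_2$; $x\leq' a$ iff $x_1\leq_P a$ and $x_2\leq_P a$; and $R'$ consists of the pairs of $R$ contained in $X'$, the pairs $\{a,x\}$ with $\{a,x_1\}\in R$ or $\{a,x_2\}\in R$, and the pairs $\{a,x\}$ with $a\not\sim' x$ and ($a\sim_P x_1$ or $a\sim_P x_2$). A poset $(X,\leq)$ has natural twin-width at most $d$ if the red poset $(X,\leq,\emptyset)$ can be reduced to a single vertex by a sequence of contractions such that the red degree is at most $d$ at every step; the natural twin-width is the least such $d$. -}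

module Defs where

open import Data.Nat using (ℕ; _≤_; suc)
open import Data.Fin using (Fin; _≟_)
open import Data.Integer using (ℤ; 0ℤ; 1ℤ; -1ℤ)
open import Data.List using (List; length)
open import Data.List.Membership.Propositional using (_∈_)
open import Data.Product using (Σ; ∃; _×_; _,_)
open import Data.Sum using (_⊎_)
open import Data.Unit using (⊤)
open import Data.Empty using (⊥)
open import Data.Bool using (if_then_else_; _∧_; not)
open import Relation.Nullary using (¬_; does)
open import Relation.Binary using (Rel; Decidable)
open import Relation.Binary.Structures using (IsDecPartialOrder)
open import Relation.Binary.PropositionalEquality using (_≡_; _≢_)
open import Function.Bundles using (_⇔_)
open import Level using (Lift; 0ℓ) renaming (suc to lsuc)

record FinPoset (n : ℕ) : Set₁ where
  field
    _≼_ : Rel (Fin n) _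
    isDecPartialOrder : IsDecPartialOrder _≡_ _≼_
  open IsDecPartialOrder isDecPartialOrder public
    using (_≤?_)

AtMost : {A : Set} → ℕ → (A → Set) → Set
AtMost {A} d Q = Σ (List A) λ L → (length L ≤ d) × (∀ a → Q a → a ∈ L)

IsLeast : (ℕ → Set₁) → ℕ → Set₁
IsLeast Q k = Q k × (∀ k' → Q k' → k ≤ k')

matrixP : {n : ℕ} → FinPoset n → Fin n → Fin n → ℤ
matrixP P u v =
  if does (u ≤? v) then 1ℤ
  else (if does (v ≤? u) ∧ not (does (v ≟ u)) then -1ℤ else 0ℤ)
  where open FinPoset P

-- A partition of Fin n is given by a labelling; its parts are the
-- nonempty fibres of the labelling.
Labelling : ℕ → Set
Labelling n = Fin n → Fin n

Part : {n : ℕ} → Labelling n → Fin n → Set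
Part c p = ∃ λ x → c x ≡ p

ConstZone : {n : ℕ} {E : Set} → (Fin n → Fin n → E) → Labelling n → Fin n → Fin n → Set
ConstZone A c p q =
  ∀ r r' s s' → c r ≡ p → c r' ≡ p → c s ≡ q → c s' ≡ q → A r s ≡ A r' s'

RowErr≤ : {n : ℕ} {E : Set} → ℕ → (Fin n → Fin n → E) → Labelling n → Fin n → Set
RowErr≤ d A c p = AtMost d (λ q → Part c q × ¬ ConstZone A c p q)

ColErr≤ : {n : ℕ} {E : Set} → ℕ → (Fin n → Fin n → E) → Labelling n → Fin n → Set
ColErr≤ d A c p = AtMost d (λ q → Part c q × ¬ ConstZone A c q p)

ErrOK : {n : ℕ} {E : Set} → ℕ → (Fin n → Fin n → E) → Labelling n → Set
ErrOK d A c = ∀ p → Part c p → RowErr≤ d A c p × ColErr≤ d A c p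

Merge : {n : ℕ} → Labelling n → Labelling n → Set
Merge {n} c c' = Σ (Fin n) λ a → Σ (Fin n) λ b → (c a ≢ c b) ×
  (∀ x y → (c' x ≡ c' y) ⇔ ((c x ≡ c y) ⊎ (InAB a b x × InAB a b y)))
  where
  InAB : Fin n → Fin n → Fin n → Set
  InAB a b z = (c z ≡ c a) ⊎ (c z ≡ c b)

SinglePart : {n : ℕ} → Labelling n → Set
SinglePart c = ∃ λ x → ∀ y → c y ≡ c x

data SymSeq {n : ℕ} {E : Set} (A : Fin n → Fin n → E) (d : ℕ) : Labelling n → Set where
  done : ∀ {c} → ErrOK d A c → SinglePart c → SymSeq A d c
  step : ∀ {c} c' → ErrOK d A c → Merge c c' → SymSeq A d c' → SymSeq A d c

SymTwwAtMost : {n : ℕ} {E : Set} → (Fin n → Fin n → E) → ℕ → Set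
SymTwwAtMost {n} A d =
  Σ (Labelling n) λ c → (∀ x y → c x ≡ c y → x ≡ y) × SymSeq A d c

PosetSymTwwAtMost : {n : ℕ} → FinPoset n → ℕ → Set₁
PosetSymTwwAtMost P d = Lift (lsuc 0ℓ) (SymTwwAtMost (matrixP P) d)

-- A red poset whose vertices are named by elements of Fin n
-- (V says which names are current vertices).  The contracted vertex
-- x of x₁ and x₂ is given the name x₁.
record RedPoset (n : ℕ) : Set₁ where
  field
    V   : Fin n → Set
    le  : Fin n → Fin n → Set
    red : Fin n → Fin n → Set
  Comp : Fin n → Fin n → Set
  Comp a b = le a b ⊎ le b a
  RedE : Fin n → Fin n → Set
  RedE a b = red a b ⊎ red b a

record Contraction {n : ℕ} (S S' : RedPoset n) (x₁ x₂ : Fin n) : Set where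
  open RedPoset S
  open RedPoset S' renaming (V to V'; le to le'; red to red'; Comp to Comp'; RedE to RedE')
  field
    distinct : x₁ ≢ x₂
    v₁ : V x₁
    v₂ : V x₂
    vertices : ∀ y → V' y ⇔ (V y × y ≢ x₂)
    le-old   : ∀ a b → V' a → V' b → a ≢ x₁ → b ≢ x₁ → (le' a b ⇔ le a b)
    le-xx    : le' x₁ x₁
    le-ax    : ∀ a → V' a → a ≢ x₁ → (le' a x₁ ⇔ (le a x₁ × le a x₂))
    le-xa    : ∀ a → V' a → a ≢ x₁ → (le' x₁ a ⇔ (le x₁ a × le x₂ a))
    red-old  : ∀ a b → V' a → V' b → a ≢ x₁ → b ≢ x₁ → (RedE' a b ⇔ RedE a b)
    red-ax   : ∀ a → V' a → a ≢ x₁ →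
               (RedE' a x₁ ⇔ (RedE a x₁ ⊎ RedE a x₂ ⊎
                              (¬ Comp' a x₁ × (Comp a x₁ ⊎ Comp a x₂))))
    red-xx   : ¬ RedE' x₁ x₁

RedDeg≤ : {n : ℕ} → ℕ → RedPoset n → Set
RedDeg≤ d S = ∀ v → V v → AtMost d (λ a → V a × RedE v a)
  where open RedPoset S

SingleVertex : {n : ℕ} → RedPoset n → Set
SingleVertex S = ∃ λ v → V v × (∀ w → V w → w ≡ v)
  where open RedPoset S

data Reduces {n : ℕ} (d : ℕ) : RedPoset n → Set₁ where
  done : ∀ {S} → RedDeg≤ d S → SingleVertex S → Reduces d S
  step : ∀ {S} S' x₁ x₂ → RedDeg≤ d S → Contraction S S' x₁ x₂ →
         Reduces d S' → Reduces d S

initialRed : {n : ℕ} → FinPoset n → RedPoset n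
initialRed P = record { V = λ _ → ⊤ ; le = FinPoset._≼_ P ; red = λ _ _ → ⊥ }

NatTwwAtMost : {n : ℕ} → FinPoset n → ℕ → Set₁
NatTwwAtMost P d = Reduces d (initialRed P)

module Submission where

-- A partition of P (labelling c) and a red poset S correspond when S is the quotient of P by the
-- partition, the vertex r x naming the part of x: u ≤ v iff every element of part u is below
-- every element of part v, and {u, v} is red iff the two parts are mixed, i.e. neither lies
-- entirely below the other although some pair across them is comparable.  For distinct parts
-- the zone of A_P is constant exactly when they are not mixed, since the entry of one comparable
-- pair fixes the sign of the whole zone.  So the error value of a part lies between its red
-- degree and one more (the diagonal zone).  Merging two parts corresponds to contracting their
-- vertices: the quotient by the merged partition satisfies the contraction rules, and these
-- rules determine the contracted red poset.  Starting from the singletons, whose quotient is P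
-- itself, a partition sequence of error value d thus yields a contraction sequence of red
-- degree d, and a contraction sequence of red degree d a partition sequence of error value d + 1.

open import Defs
open import Data.Nat using (ℕ; _≤_; suc; s≤s)
open import Data.Fin using (Fin; _≟_)
open import Data.Fin.Properties using (any?; all?)
open import Data.List using (_∷_; map)
open import Data.List.Properties using (length-map)
open import Data.List.Membership.Propositional.Properties using (∈-map⁺)
open import Data.List.Relation.Unary.Any using (here; there)
open import Data.Integer using (ℤ; 0ℤ; 1ℤ; -1ℤ)
open import Data.Product using (∃; ∃₂; _×_; _,_; proj₁; proj₂)
open import Data.Product.Function.NonDependent.Propositional using (_×-⇔_)
open import Data.Sum using (_⊎_; inj₁; inj₂; swap; [_,_]′)
open import Data.Sum.Function.Propositional using (_⊎-⇔_)
open import Data.Empty using (⊥-elim)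
open import Data.Unit using (tt)
open import Function using (id; _∘_)
open import Function.Bundles using (_⇔_; mk⇔; Equivalence)
import Function.Properties.Equivalence as ⇔
open import Function.Related.TypeIsomorphisms using (¬-cong-⇔)
open import Level using (0ℓ; lift)
open import Relation.Nullary using (¬_; Dec; yes; no)
open import Relation.Nullary.Decidable using (_×-dec_; _⊎-dec_; _→-dec_)
open import Relation.Unary using (Pred; _⊆_; _≐_; _∪_)
  renaming (Decidable to Decidable₁; _⊥_ to Disjoint)
open import Relation.Binary.PropositionalEquality
  using (_≡_; _≢_; refl; sym; trans; cong; subst; subst₂)
open import Relation.Binary.Structures using (IsDecPartialOrder)

open Equivalence using (to; from)

drop-≡ : ∀ {X A : Set} {u v : X} → u ≢ v → (u ≡ v ⊎ A) ⇔ A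
drop-≡ u≢v = mk⇔ (λ { (inj₁ u≡v) → ⊥-elim (u≢v u≡v) ; (inj₂ a) → a }) inj₂

drop-≢ : ∀ {X A : Set} {u v : X} → u ≢ v → (u ≢ v × A) ⇔ A
drop-≢ u≢v = mk⇔ proj₂ (u≢v ,_)

atMost-image : ∀ {A B : Set} {d} {Q : A → Set} (f : A → B) →
  AtMost d Q → AtMost d (λ b → ∃ λ a → Q a × f a ≡ b)
atMost-image f (L , |L|≤d , covers) =
  map f L , subst (_≤ _) (sym (length-map f L)) |L|≤d ,
  λ { _ (a , qa , refl) → ∈-map⁺ f (covers a qa) }

atMost-insert : ∀ {A : Set} {d} {Q : A → Set} (b : A) →
  AtMost d Q → AtMost (suc d) (λ a → a ≡ b ⊎ Q a)
atMost-insert b (L , |L|≤d , covers) =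
  b ∷ L , s≤s |L|≤d , λ { a (inj₁ a≡b) → here a≡b ; a (inj₂ qa) → there (covers a qa) }

atMost-⊆ : ∀ {A : Set} {d} {Q Q' : A → Set} →
  (∀ a → Q' a → Q a) → AtMost d Q → AtMost d Q'
atMost-⊆ Q'⊆Q (L , |L|≤d , covers) = L , |L|≤d , λ a q' → covers a (Q'⊆Q a q')

module _ {n : ℕ} where

  identify : Fin n → Fin n → Fin n → Fin n
  identify x₁ x₂ s with s ≟ x₂
  ... | yes _ = x₁
  ... | no _  = s

  identify-cases : ∀ x₁ x₂ s →
    (s ≡ x₂ × identify x₁ x₂ s ≡ x₁) ⊎ (s ≢ x₂ × identify x₁ x₂ s ≡ s)
  identify-cases x₁ x₂ s with s ≟ x₂
  ... | yes s≡x₂ = inj₁ (s≡x₂ , refl)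
  ... | no s≢x₂  = inj₂ (s≢x₂ , refl)

  identify-≢ : ∀ {x₁ x₂ s} → s ≢ x₂ → identify x₁ x₂ s ≡ s
  identify-≢ {x₂ = x₂} {s} s≢x₂ with s ≟ x₂
  ... | yes s≡x₂ = ⊥-elim (s≢x₂ s≡x₂)
  ... | no _     = refl

  identify-≡-other : ∀ {x₁ x₂ u} s → u ≢ x₁ → u ≢ x₂ → (identify x₁ x₂ s ≡ u) ⇔ (s ≡ u)
  identify-≡-other {x₂ = x₂} s u≢x₁ u≢x₂ with s ≟ x₂
  ... | yes refl = mk⇔ (⊥-elim ∘ u≢x₁ ∘ sym) (⊥-elim ∘ u≢x₂ ∘ sym)
  ... | no _     = ⇔.refl

  identify-≡-x₁ : ∀ {x₁ x₂} s → (identify x₁ x₂ s ≡ x₁) ⇔ (s ≡ x₁ ⊎ s ≡ x₂)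
  identify-≡-x₁ {x₂ = x₂} s with s ≟ x₂
  ... | yes s≡x₂ = mk⇔ (λ _ → inj₂ s≡x₂) (λ _ → refl)
  ... | no s≢x₂  = mk⇔ inj₁ (λ { (inj₁ s≡x₁) → s≡x₁ ; (inj₂ s≡x₂) → ⊥-elim (s≢x₂ s≡x₂) })

  identify-≡-identify : ∀ {x₁ x₂} s t →
    (identify x₁ x₂ s ≡ identify x₁ x₂ t) ⇔
    (s ≡ t ⊎ ((s ≡ x₁ ⊎ s ≡ x₂) × (t ≡ x₁ ⊎ t ≡ x₂)))
  identify-≡-identify {x₂ = x₂} s t with s ≟ x₂ | t ≟ x₂
  ... | yes refl | yes refl = mk⇔ (λ _ → inj₁ refl) (λ _ → refl)
  ... | yes refl | no t≢x₂ = mk⇔ (λ x₁≡t → inj₂ (inj₂ refl , inj₁ (sym x₁≡t)))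
    λ { (inj₁ refl) → ⊥-elim (t≢x₂ refl)
      ; (inj₂ (_ , inj₁ t≡x₁)) → sym t≡x₁
      ; (inj₂ (_ , inj₂ t≡x₂)) → ⊥-elim (t≢x₂ t≡x₂) }
  ... | no s≢x₂ | yes refl = mk⇔ (λ s≡x₁ → inj₂ (inj₁ s≡x₁ , inj₂ refl))
    λ { (inj₁ refl) → ⊥-elim (s≢x₂ refl)
      ; (inj₂ (inj₁ s≡x₁ , _)) → s≡x₁
      ; (inj₂ (inj₂ s≡x₂ , _)) → ⊥-elim (s≢x₂ s≡x₂) }
  ... | no s≢x₂ | no t≢x₂ = mk⇔ inj₁
    λ { (inj₁ s≡t) → s≡t
      ; (inj₂ (inj₁ s≡x₁ , inj₁ t≡x₁)) → trans s≡x₁ (sym t≡x₁)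
      ; (inj₂ (inj₁ _ , inj₂ t≡x₂)) → ⊥-elim (t≢x₂ t≡x₂)
      ; (inj₂ (inj₂ s≡x₂ , _)) → ⊥-elim (s≢x₂ s≡x₂) }

  RedE-sym : ∀ (S : RedPoset n) {a b} → RedPoset.RedE S a b ⇔ RedPoset.RedE S b a
  RedE-sym S = mk⇔ swap swap

  record _≈ᴿ_ (S T : RedPoset n) : Set where
    open RedPoset S
    open RedPoset T renaming (V to Vᵀ; le to leᵀ; RedE to RedEᵀ)
    field
      vertex⇔ : ∀ y → V y ⇔ Vᵀ y
      le⇔     : ∀ a b → V a → V b → le a b ⇔ leᵀ a b
      red⇔    : ∀ a b → V a → V b → RedE a b ⇔ RedEᵀ a b

  contraction-unique : ∀ {S T T' x₁ x₂} →
    Contraction S T x₁ x₂ → Contraction S T' x₁ x₂ → T ≈ᴿ T'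
  contraction-unique {T = T} {T' = T'} {x₁ = x₁} C C' =
    record { vertex⇔ = vertex⇔ ; le⇔ = le⇔ ; red⇔ = red⇔ }
    where
    module C = Contraction C
    module C' = Contraction C'
    module T = RedPoset T
    module T' = RedPoset T'

    vertex⇔ : ∀ y → T.V y ⇔ T'.V y
    vertex⇔ y = ⇔.trans (C.vertices y) (⇔.sym (C'.vertices y))

    le⇔ : ∀ a b → T.V a → T.V b → T.le a b ⇔ T'.le a b
    le⇔ a b a∈T b∈T with a ≟ x₁ | b ≟ x₁
    ... | yes refl | yes refl = mk⇔ (λ _ → C'.le-xx) (λ _ → C.le-xx)
    ... | yes refl | no b≢x₁ =
      ⇔.trans (C.le-xa b b∈T b≢x₁) (⇔.sym (C'.le-xa b (to (vertex⇔ b) b∈T) b≢x₁))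
    ... | no a≢x₁ | yes refl =
      ⇔.trans (C.le-ax a a∈T a≢x₁) (⇔.sym (C'.le-ax a (to (vertex⇔ a) a∈T) a≢x₁))
    ... | no a≢x₁ | no b≢x₁ =
      ⇔.trans (C.le-old a b a∈T b∈T a≢x₁ b≢x₁)
              (⇔.sym (C'.le-old a b (to (vertex⇔ a) a∈T) (to (vertex⇔ b) b∈T) a≢x₁ b≢x₁))

    x₁∈T : T.V x₁
    x₁∈T = from (C.vertices x₁) (C.v₁ , C.distinct)

    red-into-x₁ : ∀ a → T.V a → a ≢ x₁ → T.RedE a x₁ ⇔ T'.RedE a x₁
    red-into-x₁ a a∈T a≢x₁ =
      ⇔.trans (C.red-ax a a∈T a≢x₁)
     (⇔.trans (⇔.refl ⊎-⇔ ⇔.refl ⊎-⇔ (¬-cong-⇔ comp⇔ ×-⇔ ⇔.refl))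
              (⇔.sym (C'.red-ax a (to (vertex⇔ a) a∈T) a≢x₁)))
      where
      comp⇔ : T.Comp a x₁ ⇔ T'.Comp a x₁
      comp⇔ = le⇔ a x₁ a∈T x₁∈T ⊎-⇔ le⇔ x₁ a x₁∈T a∈T

    red⇔ : ∀ a b → T.V a → T.V b → T.RedE a b ⇔ T'.RedE a b
    red⇔ a b a∈T b∈T with a ≟ x₁ | b ≟ x₁
    ... | yes refl | yes refl = mk⇔ (⊥-elim ∘ C.red-xx) (⊥-elim ∘ C'.red-xx)
    ... | yes refl | no b≢x₁ =
      ⇔.trans (RedE-sym T) (⇔.trans (red-into-x₁ b b∈T b≢x₁) (RedE-sym T'))
    ... | no a≢x₁ | yes refl = red-into-x₁ a a∈T a≢x₁
    ... | no a≢x₁ | no b≢x₁ =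
      ⇔.trans (C.red-old a b a∈T b∈T a≢x₁ b≢x₁)
              (⇔.sym (C'.red-old a b (to (vertex⇔ a) a∈T) (to (vertex⇔ b) b∈T) a≢x₁ b≢x₁))

module _ {n : ℕ} (P : FinPoset n) where
  open FinPoset P
  open IsDecPartialOrder isDecPartialOrder using (antisym; reflexive)
    renaming (refl to ≼-refl)

  Comparable : Fin n → Fin n → Set
  Comparable x y = x ≼ y ⊎ y ≼ x

  Subset : Set₁
  Subset = Pred (Fin n) 0ℓ

  infix 4 _≼ₛ_ _≶_

  _≼ₛ_ : Subset → Subset → Set
  U ≼ₛ W = ∀ x y → U x → W y → x ≼ y

  _≶_ : Subset → Subset → Set
  U ≶ W = U ≼ₛ W ⊎ W ≼ₛ U

  Touching : Subset → Subset → Set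
  Touching U W = ∃₂ λ x y → U x × W y × Comparable x y

  Mixed : Subset → Subset → Set
  Mixed U W = ¬ (U ≶ W) × Touching U W

  private variable U U' W W' W₁ W₂ : Subset

  ≼ₛ-anti : U' ⊆ U → W' ⊆ W → U ≼ₛ W → U' ≼ₛ W'
  ≼ₛ-anti U'⊆U W'⊆W U≼W x y x∈U' y∈W' = U≼W x y (U'⊆U x∈U') (W'⊆W y∈W')

  ≼ₛ-cong : U ≐ U' → W ≐ W' → (U ≼ₛ W) ⇔ (U' ≼ₛ W')
  ≼ₛ-cong (U⊆U' , U'⊆U) (W⊆W' , W'⊆W) = mk⇔ (≼ₛ-anti U'⊆U W'⊆W) (≼ₛ-anti U⊆U' W⊆W')

  touching-mono : U ⊆ U' → W ⊆ W' → Touching U W → Touching U' W'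
  touching-mono U⊆U' W⊆W' (x , y , x∈U , y∈W , x∼y) = x , y , U⊆U' x∈U , W⊆W' y∈W , x∼y

  touching-cong : U ≐ U' → W ≐ W' → Touching U W ⇔ Touching U' W'
  touching-cong (U⊆U' , U'⊆U) (W⊆W' , W'⊆W) =
    mk⇔ (touching-mono U⊆U' W⊆W') (touching-mono U'⊆U W'⊆W)

  ≶-cong : U ≐ U' → W ≐ W' → (U ≶ W) ⇔ (U' ≶ W')
  ≶-cong U≐U' W≐W' = ≼ₛ-cong U≐U' W≐W' ⊎-⇔ ≼ₛ-cong W≐W' U≐U'

  mixed-cong : U ≐ U' → W ≐ W' → Mixed U W ⇔ Mixed U' W'
  mixed-cong U≐U' W≐W' = ¬-cong-⇔ (≶-cong U≐U' W≐W') ×-⇔ touching-cong U≐U' W≐W'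

  ≶-sym : U ≶ W → W ≶ U
  ≶-sym = swap

  touching-sym : Touching U W → Touching W U
  touching-sym (x , y , x∈U , y∈W , x∼y) = y , x , y∈W , x∈U , swap x∼y

  mixed-sym : Mixed U W → Mixed W U
  mixed-sym (¬U≶W , touch) = ¬U≶W ∘ ≶-sym , touching-sym touch

  ≶⇒touching : ∀ {x y} → U x → W y → U ≶ W → Touching U W
  ≶⇒touching {x = x} {y = y} x∈U y∈W (inj₁ U≼W) = x , y , x∈U , y∈W , inj₁ (U≼W x y x∈U y∈W)
  ≶⇒touching {x = x} {y = y} x∈U y∈W (inj₂ W≼U) = x , y , x∈U , y∈W , inj₂ (W≼U y x y∈W x∈U)

  ≼ₛ? : Decidable₁ U → Decidable₁ W → Dec (U ≼ₛ W)
  ≼ₛ? U? W? = all? λ x → all? λ y → U? x →-dec (W? y →-dec (x ≤? y))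

  touching? : Decidable₁ U → Decidable₁ W → Dec (Touching U W)
  touching? U? W? =
    any? λ x → any? λ y → U? x ×-dec (W? y ×-dec ((x ≤? y) ⊎-dec (y ≤? x)))

  ≼ₛ-∪ʳ : U ≼ₛ (W₁ ∪ W₂) ⇔ (U ≼ₛ W₁ × U ≼ₛ W₂)
  ≼ₛ-∪ʳ = mk⇔ (λ U≼W → ≼ₛ-anti id inj₁ U≼W , ≼ₛ-anti id inj₂ U≼W)
    λ { (U≼W₁ , U≼W₂) x y x∈U (inj₁ y∈W₁) → U≼W₁ x y x∈U y∈W₁
      ; (U≼W₁ , U≼W₂) x y x∈U (inj₂ y∈W₂) → U≼W₂ x y x∈U y∈W₂ }

  ≼ₛ-∪ˡ : (W₁ ∪ W₂) ≼ₛ U ⇔ (W₁ ≼ₛ U × W₂ ≼ₛ U)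
  ≼ₛ-∪ˡ = mk⇔ (λ W≼U → ≼ₛ-anti inj₁ id W≼U , ≼ₛ-anti inj₂ id W≼U)
    λ { (W₁≼U , W₂≼U) x y (inj₁ x∈W₁) y∈U → W₁≼U x y x∈W₁ y∈U
      ; (W₁≼U , W₂≼U) x y (inj₂ x∈W₂) y∈U → W₂≼U x y x∈W₂ y∈U }

  touching-∪ʳ : Touching U (W₁ ∪ W₂) ⇔ (Touching U W₁ ⊎ Touching U W₂)
  touching-∪ʳ = mk⇔
    (λ { (x , y , x∈U , inj₁ y∈W₁ , x∼y) → inj₁ (x , y , x∈U , y∈W₁ , x∼y)
       ; (x , y , x∈U , inj₂ y∈W₂ , x∼y) → inj₂ (x , y , x∈U , y∈W₂ , x∼y) })
    (λ { (inj₁ touch) → touching-mono id inj₁ touch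
       ; (inj₂ touch) → touching-mono id inj₂ touch })

  ≶-restrict : ∀ {W} → W ⊆ W₁ ∪ W₂ → U ≶ (W₁ ∪ W₂) → U ≶ W
  ≶-restrict W⊆ (inj₁ U≼W) = inj₁ (≼ₛ-anti id W⊆ U≼W)
  ≶-restrict W⊆ (inj₂ W≼U) = inj₂ (≼ₛ-anti W⊆ id W≼U)

  mixed-∪ʳ : ∀ {u w₁ w₂} → U u → W₁ w₁ → W₂ w₂ → Dec (U ≶ W₁) → Dec (U ≶ W₂) →
    Mixed U (W₁ ∪ W₂) ⇔
    (Mixed U W₁ ⊎ Mixed U W₂ ⊎ (¬ (U ≶ (W₁ ∪ W₂)) × (U ≶ W₁ ⊎ U ≶ W₂)))
  mixed-∪ʳ {U = U} {W₁ = W₁} {W₂ = W₂} u∈U w₁∈W₁ w₂∈W₂ U≶W₁? U≶W₂? = mk⇔ (split U≶W₁? U≶W₂?) join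
    where
    split : Dec (U ≶ W₁) → Dec (U ≶ W₂) → Mixed U (W₁ ∪ W₂) →
      Mixed U W₁ ⊎ Mixed U W₂ ⊎ (¬ (U ≶ (W₁ ∪ W₂)) × (U ≶ W₁ ⊎ U ≶ W₂))
    split (yes U≶W₁) _          (¬U≶W , _) = inj₂ (inj₂ (¬U≶W , inj₁ U≶W₁))
    split (no _)     (yes U≶W₂) (¬U≶W , _) = inj₂ (inj₂ (¬U≶W , inj₂ U≶W₂))
    split (no ¬U≶W₁) (no ¬U≶W₂) (_ , touch) =
      [ inj₁ ∘ (¬U≶W₁ ,_) , inj₂ ∘ inj₁ ∘ (¬U≶W₂ ,_) ]′ (to touching-∪ʳ touch)

    join : Mixed U W₁ ⊎ Mixed U W₂ ⊎ (¬ (U ≶ (W₁ ∪ W₂)) × (U ≶ W₁ ⊎ U ≶ W₂)) →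
      Mixed U (W₁ ∪ W₂)
    join (inj₁ (¬U≶W₁ , touch₁)) =
      ¬U≶W₁ ∘ ≶-restrict inj₁ , from touching-∪ʳ (inj₁ touch₁)
    join (inj₂ (inj₁ (¬U≶W₂ , touch₂))) =
      ¬U≶W₂ ∘ ≶-restrict inj₂ , from touching-∪ʳ (inj₂ touch₂)
    join (inj₂ (inj₂ (¬U≶W , inj₁ U≶W₁))) =
      ¬U≶W , from touching-∪ʳ (inj₁ (≶⇒touching u∈U w₁∈W₁ U≶W₁))
    join (inj₂ (inj₂ (¬U≶W , inj₂ U≶W₂))) =
      ¬U≶W , from touching-∪ʳ (inj₂ (≶⇒touching u∈U w₂∈W₂ U≶W₂))

  A : Fin n → Fin n → ℤ
  A = matrixP P

  matrix-≼ : ∀ {x y} → x ≼ y → A x y ≡ 1ℤ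
  matrix-≼ {x} {y} x≼y with x ≤? y
  ... | yes _  = refl
  ... | no x⋠y = ⊥-elim (x⋠y x≼y)

  matrix-≽ : ∀ {x y} → y ≼ x → x ≢ y → A x y ≡ -1ℤ
  matrix-≽ {x} {y} y≼x x≢y with x ≤? y
  ... | yes x≼y = ⊥-elim (x≢y (antisym x≼y y≼x))
  ... | no _ with y ≤? x
  ...   | no y⋠x = ⊥-elim (y⋠x y≼x)
  ...   | yes _ with y ≟ x
  ...     | yes y≡x = ⊥-elim (x≢y (sym y≡x))
  ...     | no _    = refl

  matrix-∥ : ∀ {x y} → ¬ Comparable x y → A x y ≡ 0ℤ
  matrix-∥ {x} {y} x∥y with x ≤? y
  ... | yes x≼y = ⊥-elim (x∥y (inj₁ x≼y))
  ... | no _ with y ≤? x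
  ...   | yes y≼x = ⊥-elim (x∥y (inj₂ y≼x))
  ...   | no _    = refl

  matrix≡1⇒≼ : ∀ {x y} → A x y ≡ 1ℤ → x ≼ y
  matrix≡1⇒≼ {x} {y} Axy≡1 with x ≤? y
  ... | yes x≼y = x≼y
  ... | no _ with y ≤? x
  ...   | no _ with () ← Axy≡1
  matrix≡1⇒≼ {x} {y} Axy≡1 | no _ | yes _ with y ≟ x
  ... | yes _ with () ← Axy≡1
  ... | no _  with () ← Axy≡1

  matrix≡-1⇒≽ : ∀ {x y} → A x y ≡ -1ℤ → y ≼ x
  matrix≡-1⇒≽ {x} {y} Axy≡-1 with x ≤? y
  ... | yes _ with () ← Axy≡-1
  ... | no _ with y ≤? x
  ...   | yes y≼x = y≼x
  ...   | no _ with () ← Axy≡-1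

  ConstOn : Subset → Subset → Set
  ConstOn U W = ∀ x x' y y' → U x → U x' → W y → W y' → A x y ≡ A x' y'

  constOn-valued : ∀ {a} → (∀ x y → U x → W y → A x y ≡ a) → ConstOn U W
  constOn-valued A≡a x x' y y' x∈U x'∈U y∈W y'∈W =
    trans (A≡a x y x∈U y∈W) (sym (A≡a x' y' x'∈U y'∈W))

  constOn-below : U ≼ₛ W → ConstOn U W
  constOn-below U≼W = constOn-valued λ x y x∈U y∈W → matrix-≼ (U≼W x y x∈U y∈W)

  constOn-above : Disjoint U W → W ≼ₛ U → ConstOn U W
  constOn-above U⊥W W≼U = constOn-valued λ x y x∈U y∈W →
    matrix-≽ (W≼U y x y∈W x∈U) λ { refl → U⊥W (x∈U , y∈W) }

  constOn-apart : ¬ Touching U W → ConstOn U W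
  constOn-apart ¬touch = constOn-valued λ x y x∈U y∈W →
    matrix-∥ λ x∼y → ¬touch (x , y , x∈U , y∈W , x∼y)

  -- The sign of one comparable pair is forced on the whole zone.
  constOn⇒≶ : ConstOn U W → Touching U W → U ≶ W
  constOn⇒≶ const (x , y , x∈U , y∈W , x∼y) with x ≤? y
  ... | yes x≼y = inj₁ λ x' y' x'∈U y'∈W →
    matrix≡1⇒≼ (trans (const x' x y' y x'∈U x∈U y'∈W y∈W) (matrix-≼ x≼y))
  ... | no x⋠y = inj₂ λ y' x' y'∈W x'∈U →
    matrix≡-1⇒≽ (trans (const x' x y' y x'∈U x∈U y'∈W y∈W) (matrix-≽ y≼x x≢y))
    where
    y≼x : y ≼ x
    y≼x = [ ⊥-elim ∘ x⋠y , id ]′ x∼y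
    x≢y : x ≢ y
    x≢y = x⋠y ∘ reflexive

  mixed⇔¬constOn : Disjoint U W → Dec (Touching U W) → Mixed U W ⇔ (¬ ConstOn U W)
  mixed⇔¬constOn {U = U} {W = W} U⊥W touch? = mk⇔
    (λ { (¬U≶W , touch) const → ¬U≶W (constOn⇒≶ const touch) })
    (λ ¬const → ¬U≶W ¬const , touching touch? ¬const)
    where
    ¬U≶W : ¬ ConstOn U W → ¬ (U ≶ W)
    ¬U≶W ¬const (inj₁ U≼W) = ¬const (constOn-below U≼W)
    ¬U≶W ¬const (inj₂ W≼U) = ¬const (constOn-above U⊥W W≼U)
    touching : Dec (Touching U W) → ¬ ConstOn U W → Touching U W
    touching (yes touch) _      = touch
    touching (no ¬touch) ¬const = ⊥-elim (¬const (constOn-apart ¬touch))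

  constOn-cong : U ≐ U' → W ≐ W' → ConstOn U W ⇔ ConstOn U' W'
  constOn-cong (U⊆U' , U'⊆U) (W⊆W' , W'⊆W) = mk⇔
    (λ const x x' y y' x∈ x'∈ y∈ y'∈ → const x x' y y' (U'⊆U x∈) (U'⊆U x'∈) (W'⊆W y∈) (W'⊆W y'∈))
    (λ const x x' y y' x∈ x'∈ y∈ y'∈ → const x x' y y' (U⊆U' x∈) (U⊆U' x'∈) (W⊆W' y∈) (W⊆W' y'∈))

  Block : (Fin n → Fin n) → Fin n → Subset
  Block r u x = r x ≡ u

  block? : ∀ r u → Decidable₁ (Block r u)
  block? r u x = r x ≟ u

  block-disjoint : ∀ {r u v} → u ≢ v → Disjoint (Block r u) (Block r v)
  block-disjoint u≢v (rx≡u , rx≡v) = u≢v (trans (sym rx≡u) rx≡v)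

  blocks-≶? : ∀ r u v → Dec (Block r u ≶ Block r v)
  blocks-≶? r u v = ≼ₛ? (block? r u) (block? r v) ⊎-dec ≼ₛ? (block? r v) (block? r u)

  MixedBlocks : (Fin n → Fin n) → Fin n → Fin n → Set
  MixedBlocks r u v = u ≢ v × Mixed (Block r u) (Block r v)

  mixedBlocks-sym : ∀ {r u v} → MixedBlocks r u v → MixedBlocks r v u
  mixedBlocks-sym (u≢v , mixed) = u≢v ∘ sym , mixed-sym mixed

  merged : (Fin n → Fin n) → Fin n → Fin n → Fin n → Fin n
  merged r x₁ x₂ x = identify x₁ x₂ (r x)

  merged-block-other : ∀ {r x₁ x₂ u} → u ≢ x₁ → u ≢ x₂ → Block (merged r x₁ x₂) u ≐ Block r u
  merged-block-other {r} u≢x₁ u≢x₂ =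
    (λ {x} → to (identify-≡-other (r x) u≢x₁ u≢x₂)) ,
    (λ {x} → from (identify-≡-other (r x) u≢x₁ u≢x₂))

  merged-block-x₁ : ∀ {r x₁ x₂} → Block (merged r x₁ x₂) x₁ ≐ (Block r x₁ ∪ Block r x₂)
  merged-block-x₁ {r} = (λ {x} → to (identify-≡-x₁ (r x))) , (λ {x} → from (identify-≡-x₁ (r x)))

  quotient : (Fin n → Fin n) → RedPoset n
  quotient r = record
    { V   = λ u → r u ≡ u
    ; le  = λ u v → u ≡ v ⊎ Block r u ≼ₛ Block r v
    ; red = MixedBlocks r
    }

  quotient-red⇔mixed : ∀ {r u v} → RedPoset.RedE (quotient r) u v ⇔ MixedBlocks r u v
  quotient-red⇔mixed = mk⇔ (λ { (inj₁ mixed) → mixed ; (inj₂ mixed) → mixedBlocks-sym mixed }) inj₁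

  quotient-comp⇔≶ : ∀ {r u v} → u ≢ v →
    RedPoset.Comp (quotient r) u v ⇔ (Block r u ≶ Block r v)
  quotient-comp⇔≶ u≢v = drop-≡ u≢v ⊎-⇔ drop-≡ (u≢v ∘ sym)

  record Represents (S : RedPoset n) (c r : Fin n → Fin n) : Set where
    open RedPoset S
    field
      rep-vertex : ∀ x → V (r x)
      rep-fixes  : ∀ v → V v → r v ≡ v
      rep-labels : ∀ x y → (r x ≡ r y) ⇔ (c x ≡ c y)
      le⇔below   : ∀ u v → V u → V v → le u v ⇔ (u ≡ v ⊎ Block r u ≼ₛ Block r v)
      red⇔mixed  : ∀ u v → V u → V v → RedE u v ⇔ MixedBlocks r u v

  quotient-represents : ∀ {c r} → (∀ x → r (r x) ≡ r x) →
    (∀ x y → (r x ≡ r y) ⇔ (c x ≡ c y)) → Represents (quotient r) c r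
  quotient-represents r-idem r-labels = record
    { rep-vertex = r-idem
    ; rep-fixes  = λ _ rv≡v → rv≡v
    ; rep-labels = r-labels
    ; le⇔below   = λ _ _ _ _ → ⇔.refl
    ; red⇔mixed  = λ _ _ _ _ → quotient-red⇔mixed
    }

  represents-resp-≈ᴿ : ∀ {S T c r} → S ≈ᴿ T → Represents S c r → Represents T c r
  represents-resp-≈ᴿ {S} {T} S≈T R = record
    { rep-vertex = λ x → to (vertex⇔ _) (rep-vertex x)
    ; rep-fixes  = λ v v∈T → rep-fixes v (in-S v∈T)
    ; rep-labels = rep-labels
    ; le⇔below   = λ u v u∈T v∈T →
        ⇔.trans (⇔.sym (le⇔ u v (in-S u∈T) (in-S v∈T))) (le⇔below u v (in-S u∈T) (in-S v∈T))
    ; red⇔mixed  = λ u v u∈T v∈T →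
        ⇔.trans (⇔.sym (red⇔ u v (in-S u∈T) (in-S v∈T))) (red⇔mixed u v (in-S u∈T) (in-S v∈T))
    }
    where
    open _≈ᴿ_ S≈T
    open Represents R
    in-S : ∀ {u} → RedPoset.V T u → RedPoset.V S u
    in-S = from (vertex⇔ _)

  initial-represents : ∀ {c} → (∀ x y → c x ≡ c y → x ≡ y) →
    Represents (initialRed P) c id
  initial-represents {c} c-injective = record
    { rep-vertex = λ _ → tt
    ; rep-fixes  = λ _ _ → refl
    ; rep-labels = λ x y → mk⇔ (cong c) (c-injective x y)
    ; le⇔below   = λ u v _ _ → mk⇔ (λ u≼v → inj₂ λ { _ _ refl refl → u≼v })
        λ { (inj₁ refl) → ≼-refl ; (inj₂ u≼v) → u≼v u v refl refl }
    ; red⇔mixed  = λ _ _ _ _ → mk⇔ (λ { (inj₁ ()) ; (inj₂ ()) })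
        λ { (_ , ¬u≶v , touch) → ⊥-elim (¬u≶v (singletons-≶ touch)) }
    }
    where
    singletons-≶ : ∀ {u v} → Touching (Block id u) (Block id v) →
      Block id u ≶ Block id v
    singletons-≶ (_ , _ , refl , refl , inj₁ u≼v) = inj₁ λ { _ _ refl refl → u≼v }
    singletons-≶ (_ , _ , refl , refl , inj₂ v≼u) = inj₂ λ { _ _ refl refl → v≼u }

  module _ {S c r} (R : Represents S c r) where
    open RedPoset S
    open Represents R

    label-rep : ∀ x → c (r x) ≡ c x
    label-rep x = to (rep-labels (r x) x) (rep-fixes (r x) (rep-vertex x))

    label-block : ∀ x → Block c (c x) ≐ Block r (r x)
    label-block x = (λ {z} → from (rep-labels z x)) , (λ {z} → to (rep-labels z x))

    distinct-reps : ∀ {x y} → c x ≢ c y → r x ≢ r y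
    distinct-reps cx≢cy = cx≢cy ∘ to (rep-labels _ _)

    le⇔below-distinct : ∀ {u v} → V u → V v → u ≢ v → le u v ⇔ (Block r u ≼ₛ Block r v)
    le⇔below-distinct u∈S v∈S u≢v = ⇔.trans (le⇔below _ _ u∈S v∈S) (drop-≡ u≢v)

    comp⇔≶ : ∀ {u v} → V u → V v → u ≢ v → Comp u v ⇔ (Block r u ≶ Block r v)
    comp⇔≶ u∈S v∈S u≢v =
      le⇔below-distinct u∈S v∈S u≢v ⊎-⇔ le⇔below-distinct v∈S u∈S (u≢v ∘ sym)

    red⇔mixed-distinct : ∀ {u v} → V u → V v → u ≢ v →
      RedE u v ⇔ Mixed (Block r u) (Block r v)
    red⇔mixed-distinct u∈S v∈S u≢v = ⇔.trans (red⇔mixed _ _ u∈S v∈S) (drop-≢ u≢v)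

    zone-nonconstant⇔red : ∀ x y → r x ≢ r y →
      (¬ ConstZone A c (c x) (c y)) ⇔ RedE (r x) (r y)
    zone-nonconstant⇔red x y rx≢ry =
      ⇔.trans (¬-cong-⇔ (constOn-cong (label-block x) (label-block y)))
     (⇔.trans (⇔.sym (mixed⇔¬constOn (block-disjoint {r = r} rx≢ry)
                                      (touching? (block? r (r x)) (block? r (r y)))))
              (⇔.sym (red⇔mixed-distinct (rep-vertex x) (rep-vertex y) rx≢ry)))

    -- The extra 1 accounts for the diagonal zone of each part.
    red-degree⇒error-values : ∀ {d} → RedDeg≤ d S → ErrOK (suc d) A c
    red-degree⇒error-values deg .(c x) (x , refl) = bound row , bound col
      where
      Accounted : Fin n → Set
      Accounted q = q ≡ c x ⊎ ∃ λ v → (V v × RedE (r x) v) × c v ≡ q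

      bound : ∀ {Q} → (∀ q → Q q → Accounted q) → AtMost _ Q
      bound classify =
        atMost-⊆ classify (atMost-insert (c x) (atMost-image c (deg (r x) (rep-vertex x))))

      row : ∀ q → Part c q × ¬ ConstZone A c (c x) q → Accounted q
      row .(c y) ((y , refl) , nonconst) with c y ≟ c x
      ... | yes cy≡cx = inj₁ cy≡cx
      ... | no cy≢cx = inj₂ (r y , (rep-vertex y , red-xy) , label-rep y)
        where
        red-xy : RedE (r x) (r y)
        red-xy = to (zone-nonconstant⇔red x y (distinct-reps (cy≢cx ∘ sym))) nonconst

      col : ∀ q → Part c q × ¬ ConstZone A c q (c x) → Accounted q
      col .(c y) ((y , refl) , nonconst) with c y ≟ c x
      ... | yes cy≡cx = inj₁ cy≡cx
      ... | no cy≢cx = inj₂ (r y , (rep-vertex y , red-xy) , label-rep y)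
        where
        red-xy : RedE (r x) (r y)
        red-xy = to (RedE-sym S) (to (zone-nonconstant⇔red y x (distinct-reps cy≢cx)) nonconst)

    -- Some vertex representing label q (junk value q if no element carries that label).
    vertex-of : Fin n → Fin n
    vertex-of q with any? (λ x → c x ≟ q)
    ... | yes (x , _) = r x
    ... | no _        = q

    vertex-of-label : ∀ x → vertex-of (c x) ≡ r x
    vertex-of-label x with any? (λ z → c z ≟ c x)
    ... | yes (z , cz≡cx) = from (rep-labels z x) cz≡cx
    ... | no ∄z           = ⊥-elim (∄z (x , refl))

    error-values⇒red-degree : ∀ {d} → ErrOK d A c → RedDeg≤ d S
    error-values⇒red-degree ok v v∈S =
      atMost-⊆ classify (atMost-image vertex-of (proj₁ (ok (c v) (v , refl))))
      where
      classify : ∀ a → V a × RedE v a →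
        ∃ λ q → (Part c q × ¬ ConstZone A c (c v) q) × vertex-of q ≡ a
      classify a (a∈S , red) =
        c a , ((a , refl) , nonconst) , trans (vertex-of-label a) (rep-fixes a a∈S)
        where
        red' : RedE (r v) (r a)
        red' = subst₂ RedE (sym (rep-fixes v v∈S)) (sym (rep-fixes a a∈S)) red
        rv≢ra : r v ≢ r a
        rv≢ra = proj₁ (to (red⇔mixed _ _ (rep-vertex v) (rep-vertex a)) red')
        nonconst : ¬ ConstZone A c (c v) (c a)
        nonconst = from (zone-nonconstant⇔red v a rv≢ra) red'

    singlePart⇒singleVertex : SinglePart c → SingleVertex S
    singlePart⇒singleVertex (x , one-part) =
      r x , rep-vertex x ,
      λ w w∈S → trans (sym (rep-fixes w w∈S)) (from (rep-labels w x) (one-part w))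

    singleVertex⇒singlePart : SingleVertex S → SinglePart c
    singleVertex⇒singlePart (v , v∈S , one-vertex) =
      v , λ y → to (rep-labels y v)
                   (trans (one-vertex (r y) (rep-vertex y)) (sym (rep-fixes v v∈S)))

    merged-partition : ∀ {x₁ x₂} a b → r a ≡ x₁ → r b ≡ x₂ → ∀ x y →
      (merged r x₁ x₂ x ≡ merged r x₁ x₂ y) ⇔
      ((c x ≡ c y) ⊎ ((c x ≡ c a ⊎ c x ≡ c b) × (c y ≡ c a ⊎ c y ≡ c b)))
    merged-partition a b refl refl x y =
      ⇔.trans (identify-≡-identify (r x) (r y))
              (rep-labels x y ⊎-⇔
                 (rep-labels x a ⊎-⇔ rep-labels x b) ×-⇔ (rep-labels y a ⊎-⇔ rep-labels y b))

    module _ {x₁ x₂} (x₁∈S : V x₁) (x₂∈S : V x₂) (x₁≢x₂ : x₁ ≢ x₂) where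

      private
        r' : Fin n → Fin n
        r' = merged r x₁ x₂
        open RedPoset (quotient r') renaming (V to V'; le to le'; RedE to RedE'; Comp to Comp')

      merged-idempotent : ∀ x → r' (r' x) ≡ r' x
      merged-idempotent x with identify-cases x₁ x₂ (r x)
      ... | inj₁ (_ , r'x≡x₁) rewrite r'x≡x₁ =
        trans (cong (identify x₁ x₂) (rep-fixes x₁ x₁∈S)) (identify-≢ x₁≢x₂)
      ... | inj₂ (rx≢x₂ , r'x≡rx) rewrite r'x≡rx =
        trans (cong (identify x₁ x₂) (rep-fixes (r x) (rep-vertex x))) (identify-≢ rx≢x₂)

      merged-vertex⇔ : ∀ y → (r' y ≡ y) ⇔ (V y × y ≢ x₂)
      merged-vertex⇔ y = mk⇔ to-vertex from-vertex
        where
        to-vertex : r' y ≡ y → V y × y ≢ x₂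
        to-vertex r'y≡y with identify-cases x₁ x₂ (r y)
        ... | inj₁ (_ , r'y≡x₁) = subst V x₁≡y x₁∈S , x₁≢x₂ ∘ trans x₁≡y
          where
          x₁≡y : x₁ ≡ y
          x₁≡y = trans (sym r'y≡x₁) r'y≡y
        ... | inj₂ (ry≢x₂ , r'y≡ry) = subst V ry≡y (rep-vertex y) , ry≢x₂ ∘ trans ry≡y
          where
          ry≡y : r y ≡ y
          ry≡y = trans (sym r'y≡ry) r'y≡y
        from-vertex : V y × y ≢ x₂ → r' y ≡ y
        from-vertex (y∈S , y≢x₂) = trans (cong (identify x₁ x₂) (rep-fixes y y∈S)) (identify-≢ y≢x₂)

      private
        old : ∀ {u} → V' u → V u
        old u' = proj₁ (to (merged-vertex⇔ _) u')

        fresh : ∀ {u} → V' u → u ≢ x₂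
        fresh u' = proj₂ (to (merged-vertex⇔ _) u')

        block-old : ∀ {u} → V' u → u ≢ x₁ → Block r' u ≐ Block r u
        block-old u' u≢x₁ = merged-block-other u≢x₁ (fresh u')

      merged-le-into-x₁ : ∀ u → V' u → u ≢ x₁ → le' u x₁ ⇔ (le u x₁ × le u x₂)
      merged-le-into-x₁ u u' u≢x₁ =
        ⇔.trans (drop-≡ u≢x₁)
       (⇔.trans (≼ₛ-cong (block-old u' u≢x₁) merged-block-x₁)
       (⇔.trans ≼ₛ-∪ʳ
                (⇔.sym (le⇔below-distinct (old u') x₁∈S u≢x₁ ×-⇔
                        le⇔below-distinct (old u') x₂∈S (fresh u')))))

      merged-le-from-x₁ : ∀ u → V' u → u ≢ x₁ → le' x₁ u ⇔ (le x₁ u × le x₂ u)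
      merged-le-from-x₁ u u' u≢x₁ =
        ⇔.trans (drop-≡ (u≢x₁ ∘ sym))
       (⇔.trans (≼ₛ-cong merged-block-x₁ (block-old u' u≢x₁))
       (⇔.trans ≼ₛ-∪ˡ
                (⇔.sym (le⇔below-distinct x₁∈S (old u') (u≢x₁ ∘ sym) ×-⇔
                        le⇔below-distinct x₂∈S (old u') (fresh u' ∘ sym)))))

      merged-red-with-x₁ : ∀ u → V' u → u ≢ x₁ →
        RedE' u x₁ ⇔ (RedE u x₁ ⊎ RedE u x₂ ⊎ (¬ Comp' u x₁ × (Comp u x₁ ⊎ Comp u x₂)))
      merged-red-with-x₁ u u' u≢x₁ =
        ⇔.trans quotient-red⇔mixed
       (⇔.trans (drop-≢ u≢x₁)
       (⇔.trans (mixed-cong (block-old u' u≢x₁) merged-block-x₁)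
       (⇔.trans (mixed-∪ʳ (rep-fixes u (old u')) (rep-fixes x₁ x₁∈S) (rep-fixes x₂ x₂∈S)
                          (blocks-≶? r u x₁) (blocks-≶? r u x₂))
                (⇔.sym (red⇔mixed-distinct (old u') x₁∈S u≢x₁ ⊎-⇔
                        red⇔mixed-distinct (old u') x₂∈S (fresh u') ⊎-⇔
                        ¬-cong-⇔ comp'⇔≶ ×-⇔
                          (comp⇔≶ (old u') x₁∈S u≢x₁ ⊎-⇔ comp⇔≶ (old u') x₂∈S (fresh u')))))))
        where
        comp'⇔≶ : Comp' u x₁ ⇔ (Block r u ≶ (Block r x₁ ∪ Block r x₂))
        comp'⇔≶ = ⇔.trans (quotient-comp⇔≶ u≢x₁) (≶-cong (block-old u' u≢x₁) merged-block-x₁)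

      merge-is-contraction : Contraction S (quotient r') x₁ x₂
      merge-is-contraction = record
        { distinct = x₁≢x₂
        ; v₁       = x₁∈S
        ; v₂       = x₂∈S
        ; vertices = merged-vertex⇔
        ; le-old   = λ u v u' v' u≢x₁ v≢x₁ →
            ⇔.trans (⇔.refl ⊎-⇔ ≼ₛ-cong (block-old u' u≢x₁) (block-old v' v≢x₁))
                    (⇔.sym (le⇔below u v (old u') (old v')))
        ; le-xx    = inj₁ refl
        ; le-ax    = merged-le-into-x₁
        ; le-xa    = merged-le-from-x₁
        ; red-old  = λ u v u' v' u≢x₁ v≢x₁ →
            ⇔.trans quotient-red⇔mixed
           (⇔.trans (⇔.refl ×-⇔ mixed-cong (block-old u' u≢x₁) (block-old v' v≢x₁))
                    (⇔.sym (red⇔mixed u v (old u') (old v'))))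
        ; red-ax   = merged-red-with-x₁
        ; red-xx   = λ red → proj₁ (to quotient-red⇔mixed red) refl
        }

  reduce : ∀ {d S c r} → Represents S c r → SymSeq A d c → Reduces d S
  reduce R (done ok one-part) =
    done (error-values⇒red-degree R ok) (singlePart⇒singleVertex R one-part)
  reduce {r = r} R (step c' ok (a , b , ca≢cb , c'-merges) rest) =
    step (quotient r') (r a) (r b) (error-values⇒red-degree R ok)
      (merge-is-contraction R (rep-vertex a) (rep-vertex b) ra≢rb) (reduce R' rest)
    where
    open Represents R
    r' : Fin n → Fin n
    r' = merged r (r a) (r b)
    ra≢rb : r a ≢ r b
    ra≢rb = distinct-reps R ca≢cb
    r'-labels : ∀ x y → (r' x ≡ r' y) ⇔ (c' x ≡ c' y)
    r'-labels x y = ⇔.trans (merged-partition R a b refl refl x y) (⇔.sym (c'-merges x y))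
    R' : Represents (quotient r') c' r'
    R' = quotient-represents (merged-idempotent R (rep-vertex a) (rep-vertex b) ra≢rb) r'-labels

  expand : ∀ {d S c r} → Represents S c r → Reduces d S → SymSeq A (suc d) c
  expand R (done deg one-vertex) =
    done (red-degree⇒error-values R deg) (singleVertex⇒singlePart R one-vertex)
  expand {c = c} {r} R (step S' x₁ x₂ deg C rest) =
    step r' (red-degree⇒error-values R deg)
      (x₁ , x₂ , distinct ∘ distinct-labels ,
       merged-partition R x₁ x₂ (rep-fixes x₁ v₁) (rep-fixes x₂ v₂))
      (expand R' rest)
    where
    open Represents R
    open Contraction C
    r' : Fin n → Fin n
    r' = merged r x₁ x₂
    R' : Represents S' r' r'
    R' = represents-resp-≈ᴿ (contraction-unique (merge-is-contraction R v₁ v₂ distinct) C)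
                            (quotient-represents (merged-idempotent R v₁ v₂ distinct) λ _ _ → ⇔.refl)
    distinct-labels : c x₁ ≡ c x₂ → x₁ ≡ x₂
    distinct-labels cx₁≡cx₂ =
      trans (sym (rep-fixes x₁ v₁)) (trans (from (rep-labels x₁ x₂) cx₁≡cx₂) (rep-fixes x₂ v₂))

proposition1 : ∀ (n : ℕ) (P : FinPoset n) (dₛ d : ℕ) →
    IsLeast (PosetSymTwwAtMost P) dₛ → IsLeast (NatTwwAtMost P) d →
    (d ≤ dₛ) × (dₛ ≤ suc d)
proposition1 n P dₛ d (lift (c₀ , c₀-injective , partitions) , dₛ-least) (contractions , d-least) =
  d-least dₛ (reduce P (initial-represents P c₀-injective) partitions) ,
  dₛ-least (suc d)
    (lift (id , id-injective , expand P (initial-represents P id-injective) contractions))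
  where
  id-injective : ∀ (x y : Fin n) → id x ≡ id y → x ≡ y
  id-injective _ _ = id
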